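{- (1) For any normal expression $e$ of the split fireball calculus, there exists a type derivation $\pi\triangleright\Gamma\vdash e:M$ for some type context $\Gamma$ and some multi type $M$. (2) For any multi type $N$ and any inert term $i$, there exists a type derivation $\sigma\triangleright\Delta\vdash i:N$ for some type context $\Delta$.
   Context: Terms: $t,u ::= x \mid \lambda x.t \mid tu$, up to $\alpha$-equivalence; $t\{x\leftarrow u\}$ is capture-avoiding substitution. Values: $v ::= x \mid \lambda x.t$. Fireballs $f$ and inert terms $i$ are defined by mutual induction: $f ::= v \mid i$ and $i ::= x f_1 \dots f_n$ with $n>0$ (application left-associative). Right evaluation contexts: $C ::= \langle\cdot\rangle \mid t\,C \mid C\,f$. Split fireball calculus: environments $E ::= \epsilon \mid [x\leftarrow i]:E$; programs $p=(t,E)$; expressions are terms or programs. Reduction: $(C\langle(\lambda x.t)v\rangle,E)\to_{\beta_v}(C\langle t\{x\leftarrow v\}\rangle,E)$ and $(C\langle(\lambda x.t)i\rangle,E)\to_{\beta_i}(C\langle t\rangle,[x\leftarrow i]:E)$; $\to_{\beta_f}=\to_{\beta_v}\cup\to_{\beta_i}$. A program is normal if it has no $\to_{\beta_f}$-reduct; a normal expression is a normal program or a term $t$ such that $(t,E)$ is normal for every environment $E$. Append: $\epsilon@[x\leftarrow i]=[x\leftarrow i]$, $([y\leftarrow i']:E)@[x\leftarrow i]=[y\leftarrow i']:(E@[x\leftarrow i])$. Multi types: linear types $L ::= M\multimap N$; multi types $M,N ::= [L_1,\dots,L_n]$ (finite multisets, $n\ge 0$); $\mathbf 0$ empty multiset,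 $\uplus$ multiset sum. Type context $\Gamma$: total map from variables to multi types with finite $\mathrm{dom}(\Gamma)=\{x\mid \Gamma(x)\ne\mathbf 0\}$; $(\Gamma\uplus\Delta)(x)=\Gamma(x)\uplus\Delta(x)$; $x:M$ maps $x$ to $M$ and all else to $\mathbf 0$; $\Gamma,x:M$ extends $\Gamma$ ($x\notin\mathrm{dom}(\Gamma)$) by $x\mapsto M$. Typing rules: (ax) $x:M\vdash x:M$; (@) from $\Gamma\vdash t:[M\multimap N]$ and $\Delta\vdash u:M$ infer $\Gamma\uplus\Delta\vdash tu:N$; ($\lambda$) from $\Gamma_k,x:M_k\vdash t:N_k$ for $k=1,\dots,n$ ($n\ge0$) infer $\Gamma_1\uplus\dots\uplus\Gamma_n\vdash\lambda x.t:[M_1\multimap N_1,\dots,M_n\multimap N_n]$; (es$_\epsilon$) from $\Gamma\vdash t:M$ infer $\Gamma\vdash (t,\epsilon):M$; (es$_@$) from $\Gamma,x:M\vdash(t,E):N$ and $\Delta\vdash i:M$ infer $\Gamma\uplus\Delta\vdash(t,E@[x\leftarrow i]):N$. -}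

module Defs where

open import Data.Nat using (ℕ; suc; _⊔_; _≡ᵇ_; _≤_)
open import Data.Bool using (if_then_else_)
open import Data.List using (List; []; _∷_; _++_; [_]; map; concatMap; foldr)
open import Data.List.Relation.Unary.All using (All)
open import Data.Product using (Σ; _×_; _,_; proj₁; proj₂; ∃)
open import Relation.Binary.PropositionalEquality using (_≡_; _≢_)
open import Relation.Nullary using (¬_)

Var : Set
Var = ℕ

data Term : Set where
  var : Var → Term
  lam : Var → Term → Term
  app : Term → Term → Term

fv : Term → List Var
fv (var x)   = [ x ]
fv (lam x t) = removeV x (fv t)
  where
  removeV : Var → List Var → List Var
  removeV x [] = []
  removeV x (y ∷ ys) = if y ≡ᵇ x then removeV x ys else y ∷ removeV x ys
fv (app t u) = fv t ++ fv u

fresh : List Var → Var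
fresh xs = suc (foldr _⊔_ 0 xs)

-- capture-avoiding simultaneous substitution; 'avoid' contains every
-- name that may occur free in the image of the substitution.
substS : (Var → Term) → List Var → Term → Term
substS σ avoid (var x)   = σ x
substS σ avoid (lam y t) =
  let z = fresh avoid in
  lam z (substS (λ w → if w ≡ᵇ y then var z else σ w) (z ∷ avoid) t)
substS σ avoid (app t u) = app (substS σ avoid t) (substS σ avoid u)

_[_≔_] : Term → Var → Term → Term
t [ x ≔ u ] =
  substS (λ w → if w ≡ᵇ x then u else var w) (x ∷ fv u ++ fv t) t

data Value : Term → Set where
  v-var : ∀ {x} → Value (var x)
  v-lam : ∀ {x t} → Value (lam x t)

data Fireball : Term → Set
data Inert : Term → Set

data Fireball where
  f-val   : ∀ {t} → Value t → Fireball t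
  f-inert : ∀ {t} → Inert t → Fireball t

data Inert where
  i-var : ∀ {x f} → Fireball f → Inert (app (var x) f)
  i-app : ∀ {i f} → Inert i → Fireball f → Inert (app i f)

data ECtx : Set where
  hole : ECtx
  ctxR : Term → ECtx → ECtx
  ctxL : ECtx → (f : Term) → Fireball f → ECtx

plug : ECtx → Term → Term
plug hole         s = s
plug (ctxR t C)   s = app t (plug C s)
plug (ctxL C f _) s = app (plug C s) f

EnvEntry : Set
EnvEntry = Var × Σ Term Inert

Env : Set
Env = List EnvEntry                -- ε = [],  [x←i]:E = (x , i) ∷ E

_⊕[_←_] : Env → Var → Σ Term Inert → Env
E ⊕[ x ← i ] = E ++ [ (x , i) ]

Prog : Set
Prog = Term × Env

data _→βf_ : Prog → Prog → Set where
  βv : ∀ {C x t v E} → Value v →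
       (plug C (app (lam x t) v) , E) →βf (plug C (t [ x ≔ v ]) , E)
  βi : ∀ {C x t i E} → (ii : Inert i) →
       (plug C (app (lam x t) i) , E) →βf (plug C t , (x , (i , ii)) ∷ E)

NormalProg : Prog → Set
NormalProg p = ∀ p' → ¬ (p →βf p')

data Expr : Set where
  term : Term → Expr
  prog : Prog → Expr

NormalExpr : Expr → Set
NormalExpr (term t) = ∀ E → NormalProg (t , E)
NormalExpr (prog p) = NormalProg p

-- Multi types (multisets represented by lists)

data LType : Set where
  _⊸_ : List LType → List LType → LType

MType : Set
MType = List LType

𝟘 : MType
𝟘 = []

TyCtx : Set
TyCtx = Var → MType

FiniteDom : TyCtx → Set
FiniteDom Γ = ∃ λ (b : ℕ) → ∀ y → b ≤ y → Γ y ≡ 𝟘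

-- Contexts are compared pointwise (extensionally):
-- Θ is Γ ⊎ Δ when Θ y ≡ Γ y ++ Δ y for every y, and a premise context of
-- shape "Γ , x : M" is a context Γ' with Γ' x ≡ M (Γ being Γ' with x ↦ 𝟘).
data _⊢_∶_ : TyCtx → Term → MType → Set where
  ax  : ∀ {Γ x M} → Γ x ≡ M → (∀ y → y ≢ x → Γ y ≡ 𝟘) →
        Γ ⊢ var x ∶ M
  app : ∀ {Γ Δ Θ t u M N} →
        Γ ⊢ t ∶ [ M ⊸ N ] → Δ ⊢ u ∶ M →
        (∀ y → Θ y ≡ Γ y ++ Δ y) →
        Θ ⊢ app t u ∶ N
  lam : ∀ {Θ x t} (ds : List (TyCtx × MType)) →
        All (λ d → proj₁ d ⊢ t ∶ proj₂ d) ds →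
        Θ x ≡ 𝟘 →
        (∀ y → y ≢ x → Θ y ≡ concatMap (λ d → proj₁ d y) ds) →
        Θ ⊢ lam x t ∶ map (λ d → proj₁ d x ⊸ proj₂ d) ds

data _⊢p_∶_ : TyCtx → Prog → MType → Set where
  es-ε : ∀ {Γ t M} → Γ ⊢ t ∶ M → Γ ⊢p (t , []) ∶ M
  es-app : ∀ {Γ' Δ Θ t E x i N} {ii : Inert i} →
         Γ' ⊢p (t , E) ∶ N → Δ ⊢ i ∶ Γ' x →
         Θ x ≡ Δ x →
         (∀ y → y ≢ x → Θ y ≡ Γ' y ++ Δ y) →
         Θ ⊢p (t , E ⊕[ x ← (i , ii) ]) ∶ N

_⊢e_∶_ : TyCtx → Expr → MType → Set
Γ ⊢e term t ∶ M = Γ ⊢ t ∶ M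
Γ ⊢e prog p ∶ M = Γ ⊢p p ∶ M

-- A normal program cannot fire a β-redex, so its term is a fireball. Values
-- are typed at 𝟘 (an axiom with x : 𝟘, or a λ with no premises), and an
-- inert term x f₁ … fₙ can be given ANY type N: type each fᵢ at some Mᵢ and
-- give the head x the arrow type [M₁ ⊸ [M₂ ⊸ … [Mₙ ⊸ N]]]. The latter also
-- types each substitution [x ← i] of an environment, at whatever type the
-- program typed so far demands for x.
module Submission where

open import Defs
open import Data.Product using (_×_; ∃; _,_)
open import Data.Nat using (suc; _⊔_)
open import Data.Nat.Properties using (_≟_; m⊔n≤o⇒m≤o; m⊔n≤o⇒n≤o; <-irrefl)
open import Data.List using ([]; _∷_; _++_; [_])
open import Data.List.Properties using (++-assoc; ++-identityʳ)
open import Data.List.Relation.Unary.All using ([])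
open import Relation.Binary.PropositionalEquality using (_≡_; _≢_; refl; sym; trans; cong₂; subst)
open import Relation.Nullary using (yes; no)
open import Data.Empty using (⊥-elim)

NormalProg-appʳ : ∀ {t u E} → NormalProg (app t u , E) → NormalProg (u , E)
NormalProg-appʳ {t} n _ (βv {C} v)  = n _ (βv {C = ctxR t C} v)
NormalProg-appʳ {t} n _ (βi {C} ii) = n _ (βi {C = ctxR t C} ii)

NormalProg-appˡ : ∀ {t u E} → Fireball u → NormalProg (app t u , E) → NormalProg (t , E)
NormalProg-appˡ {u = u} fu n _ (βv {C} v)  = n _ (βv {C = ctxL C u fu} v)
NormalProg-appˡ {u = u} fu n _ (βi {C} ii) = n _ (βi {C = ctxL C u fu} ii)

NormalProg⇒Fireball : ∀ t {E} → NormalProg (t , E) → Fireball t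
NormalProg⇒Fireball (var x)   n = f-val v-var
NormalProg⇒Fireball (lam x t) n = f-val v-lam
NormalProg⇒Fireball (app t u) n
  with fu ← NormalProg⇒Fireball u (NormalProg-appʳ n)
  with NormalProg⇒Fireball t (NormalProg-appˡ fu n) | fu
... | f-val v-var  | _           = f-inert (i-var fu)
... | f-inert it   | _           = f-inert (i-app it fu)
... | f-val v-lam  | f-val v     = ⊥-elim (n _ (βv {C = hole} v))
... | f-val v-lam  | f-inert ii  = ⊥-elim (n _ (βi {C = hole} ii))

∅ : TyCtx
∅ _ = 𝟘

_∪_ : TyCtx → TyCtx → TyCtx
(Γ ∪ Δ) y = Γ y ++ Δ y

_[_↦_] : TyCtx → Var → MType → TyCtx
(Γ [ x ↦ M ]) y with y ≟ x
... | yes _ = M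
... | no  _ = Γ y

[↦]-≡ : ∀ Γ x M → (Γ [ x ↦ M ]) x ≡ M
[↦]-≡ Γ x M with x ≟ x
... | yes _  = refl
... | no x≢x = ⊥-elim (x≢x refl)

[↦]-≢ : ∀ Γ x M y → y ≢ x → (Γ [ x ↦ M ]) y ≡ Γ y
[↦]-≢ Γ x M y y≢x with y ≟ x
... | yes y≡x = ⊥-elim (y≢x y≡x)
... | no  _   = refl

FiniteDom-∅ : FiniteDom ∅
FiniteDom-∅ = 0 , λ _ _ → refl

FiniteDom-∪ : ∀ {Γ Δ} → FiniteDom Γ → FiniteDom Δ → FiniteDom (Γ ∪ Δ)
FiniteDom-∪ (b , Γ≡𝟘) (c , Δ≡𝟘) = b ⊔ c , λ y b⊔c≤y →
  cong₂ _++_ (Γ≡𝟘 y (m⊔n≤o⇒m≤o b c b⊔c≤y)) (Δ≡𝟘 y (m⊔n≤o⇒n≤o b c b⊔c≤y))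

FiniteDom-[↦] : ∀ {Γ} x M → FiniteDom Γ → FiniteDom (Γ [ x ↦ M ])
FiniteDom-[↦] {Γ} x M (b , Γ≡𝟘) = suc x ⊔ b , λ y bound≤y →
  trans ([↦]-≢ Γ x M y (λ { refl → <-irrefl refl (m⊔n≤o⇒m≤o (suc x) b bound≤y) }))
        (Γ≡𝟘 y (m⊔n≤o⇒n≤o (suc x) b bound≤y))

Typable : Term → MType → Set
Typable t M = ∃ λ Γ → FiniteDom Γ × Γ ⊢ t ∶ M

Typableᵖ : Prog → MType → Set
Typableᵖ p M = ∃ λ Γ → FiniteDom Γ × Γ ⊢p p ∶ M

mutual
  Fireball⇒Typable : ∀ {f} → Fireball f → ∃ λ M → Typable f M
  Fireball⇒Typable (f-val v-var)  = 𝟘 , ∅ , FiniteDom-∅ , ax refl (λ _ _ → refl)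
  Fireball⇒Typable (f-val v-lam)  = 𝟘 , ∅ , FiniteDom-∅ , lam [] [] refl (λ _ _ → refl)
  Fireball⇒Typable (f-inert it)   = 𝟘 , Inert⇒Typable 𝟘 it

  Inert⇒Typable : ∀ {i} N → Inert i → Typable i N
  Inert⇒Typable N (i-var {x} ff)
    with M , Γ , Γ-fin , ⊢f ← Fireball⇒Typable ff =
    (∅ [ x ↦ [ M ⊸ N ] ]) ∪ Γ ,
    FiniteDom-∪ (FiniteDom-[↦] x _ FiniteDom-∅) Γ-fin ,
    app (ax ([↦]-≡ ∅ x _) ([↦]-≢ ∅ x _)) ⊢f (λ _ → refl)
  Inert⇒Typable N (i-app it ff)
    with M , Γ , Γ-fin , ⊢f ← Fireball⇒Typable ff
    with Δ , Δ-fin , ⊢i ← Inert⇒Typable [ M ⊸ N ] it =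
    Δ ∪ Γ , FiniteDom-∪ Δ-fin Γ-fin , app ⊢i ⊢f (λ _ → refl)

-- Typing i at Γ x discharges what (t , E) demands of x; afterwards x keeps
-- only its occurrences in i.
Typableᵖ-⊕ : ∀ {t E N} x {i} (it : Inert i) →
             Typableᵖ (t , E) N → Typableᵖ (t , E ⊕[ x ← (i , it) ]) N
Typableᵖ-⊕ x it (Γ , Γ-fin , ⊢p)
  with Δ , Δ-fin , ⊢i ← Inert⇒Typable (Γ x) it =
  (Γ ∪ Δ) [ x ↦ Δ x ] ,
  FiniteDom-[↦] x _ (FiniteDom-∪ Γ-fin Δ-fin) ,
  es-app ⊢p ⊢i ([↦]-≡ (Γ ∪ Δ) x _) ([↦]-≢ (Γ ∪ Δ) x _)

Typableᵖ-++ : ∀ {t E N} E' → Typableᵖ (t , E) N → Typableᵖ (t , E ++ E') N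
Typableᵖ-++ {t} {E} {N} [] ⊢p =
  subst (λ E″ → Typableᵖ (t , E″) N) (sym (++-identityʳ E)) ⊢p
Typableᵖ-++ {t} {E} {N} ((x , (i , it)) ∷ E') ⊢p =
  subst (λ E″ → Typableᵖ (t , E″) N) (++-assoc E [ (x , (i , it)) ] E')
    (Typableᵖ-++ E' (Typableᵖ-⊕ x it ⊢p))

proposition8 :
    ((e : Expr) → NormalExpr e →
      ∃ λ (Γ : TyCtx) → FiniteDom Γ × ∃ λ (M : MType) → Γ ⊢e e ∶ M)
    ×
    ((N : MType) (i : Term) → Inert i →
      ∃ λ (Δ : TyCtx) → FiniteDom Δ × Δ ⊢ i ∶ N)
proposition8 = NormalExpr⇒Typable , λ N _ → Inert⇒Typable N
  where
  NormalExpr⇒Typable : (e : Expr) → NormalExpr e →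
    ∃ λ (Γ : TyCtx) → FiniteDom Γ × ∃ λ (M : MType) → Γ ⊢e e ∶ M
  NormalExpr⇒Typable (term t) n
    with M , Γ , Γ-fin , ⊢t ← Fireball⇒Typable (NormalProg⇒Fireball t (n [])) =
    Γ , Γ-fin , M , ⊢t
  NormalExpr⇒Typable (prog (t , E)) n
    with M , Γ , Γ-fin , ⊢t ← Fireball⇒Typable (NormalProg⇒Fireball t n)
    with Γ' , Γ'-fin , ⊢p ← Typableᵖ-++ E (Γ , Γ-fin , es-ε ⊢t) =
    Γ' , Γ'-fin , M , ⊢p
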